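{- Let $\to$ denote one-step reduction in the calculus $\lambda C$ and in the calculus VFS, and for a rule $R$ of $\lambda C$ let $\to_R$ denote one-step reduction using only $R$. Let $M^{\bullet}$ denote the VFS-translation of a $\lambda C$-term $M$. (1) Let $R\in\{B,\mathit{let}_v,\eta_{let}\}$. For all $\lambda C$-terms $M,N$, if $M\to_R N$ in $\lambda C$ then $M^{\bullet}\twoheadrightarrow N^{\bullet}$ in VFS. (2) Let $R\in\{\mathit{let}_1,\mathit{let}_2,\mathit{assoc}\}$. For all $\lambda C$-terms $M,N$, if $M\to_R N$ in $\lambda C$ then $M^{\bullet}=N^{\bullet}$ (up to $\alpha$-equivalence).
   Context: Conventions: terms are identified up to $\alpha$-equivalence; $[V/x]M$ is capture-avoiding substitution; the one-step reduction of each calculus is the closure of its rules under all syntactic constructors; $\twoheadrightarrow$ is its reflexive-transitive closure. The calculus $\lambda C$ (computational $\lambda$-calculus). Terms $M,N,P,Q ::= V \mid MN \mid \mathsf{let}\,x:=M\,\mathsf{in}\,N$; values $V,W ::= x\mid \lambda x.M$ (in $\mathsf{let}\,x:=M\,\mathsf{in}\,N$, $x$ is bound in $N$). Rules: $(B)$ $(\lambda x.M)N\to \mathsf{let}\,x:=N\,\mathsf{in}\,M$; $(\mathit{let}_v)$ $\mathsf{let}\,x:=V\,\mathsf{in}\,M\to[V/x]M$; $(\eta_{let})$ $\mathsf{let}\,x:=M\,\mathsf{in}\,x\to M$; $(\mathit{assoc})$ $\mathsf{let}\,y:=(\mathsf{let}\,x:=M\,\mathsf{in}\,N)\,\mathsf{in}\,P\to\mathsf{let}\,x:=M\,\mathsf{in}\,(\mathsf{let}\,y:=N\,\mathsf{in}\,P)$;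 $(\mathit{let}_1)$ $MN\to\mathsf{let}\,x:=M\,\mathsf{in}\,xN$ if $M$ is not a value ($x$ fresh); $(\mathit{let}_2)$ $VN\to\mathsf{let}\,x:=N\,\mathsf{in}\,Vx$ if $N$ is not a value ($x$ fresh). The calculus VFS. Terms $M,N::=\uparrow V\mid \mathsf{C}_v(V,c)$; values $V,W::=x\mid\lambda x.M$; formal contexts $c::= x.M\mid (W,x.M)$, where $x$ is bound in $M$ in both forms of formal context. Auxiliary operations $(M:c')$ (a term) and $(c:c')$ (a formal context), by simultaneous recursion: $(\uparrow V:c')=\mathsf{C}_v(V,c')$; $(\mathsf{C}_v(V,c):c')=\mathsf{C}_v(V,(c:c'))$; $((x.M):c')=x.(M:c')$; $((W,x.M):c')=(W,x.(M:c'))$. Rules: $(B_v)$ $\mathsf{C}_v(\lambda x.M,(V,y.N))\to\mathsf{C}_v(V,x.(M:y.N))$; $(\sigma_v)$ $\mathsf{C}_v(V,y.N)\to[V/y]N$ (ordinary capture-avoiding substitution). VFS-translation from $\lambda C$ to VFS: a value $V^{\circ}$, for each term $M$ and VFS formal context $x.N$ a VFS term $(M;x.N)$, and $M^{\bullet}$: $x^{\circ}=x$; $(\lambda x.M)^{\circ}=\lambda x.M^{\bullet}$; $M^{\bullet}=(M;x.\uparrow x)$; $(V;x.N)=\mathsf{C}_v(V^{\circ},x.N)$; $(PQ;x.N)=(P;m.(mQ;x.N))$ if $P$ is not a value ($m$ fresh); $(VQ;x.N)=(Q;n.(Vn;x.N))$ if $Q$ is not a value ($n$ fresh); $(VW;x.N)=\mathsf{C}_v(V^{\circ},(W^{\circ},x.N))$;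 $(\mathsf{let}\,y:=M\,\mathsf{in}\,P;x.N)=(M;y.(P;x.N))$. -}

module Defs where

-- Well-scoped de Bruijn syntax: terms are indexed by the number of free
-- variables, so alpha-equivalent terms are syntactically equal (≡) and
-- substitution is capture-avoiding by construction.

open import Data.Nat using (ℕ; zero; suc)
open import Data.Fin using (Fin; zero; suc)
open import Data.Product using (_×_; _,_)
open import Data.Sum using (_⊎_)
open import Function using (id; _∘_)
open import Relation.Binary.PropositionalEquality
  using (_≡_; refl; cong; cong₂; sym; trans)
open import Relation.Binary.Construct.Closure.ReflexiveTransitive using (Star)

Ren : ℕ → ℕ → Set
Ren n m = Fin n → Fin m

lift : ∀ {n m} → Ren n m → Ren (suc n) (suc m)
lift ρ zero    = zero
lift ρ (suc i) = suc (ρ i)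

data Tm (n : ℕ) : Set where
  var  : Fin n → Tm n
  lam  : Tm (suc n) → Tm n
  app  : Tm n → Tm n → Tm n
  lett : Tm n → Tm (suc n) → Tm n

data IsValue {n : ℕ} : Tm n → Set where
  var : (x : Fin n) → IsValue (var x)
  lam : (M : Tm (suc n)) → IsValue (lam M)

NotValue : ∀ {n} → Tm n → Set
NotValue M = IsValue M → Data.Empty.⊥
  where import Data.Empty

ren : ∀ {n m} → Ren n m → Tm n → Tm m
ren ρ (var x)    = var (ρ x)
ren ρ (lam M)    = lam (ren (lift ρ) M)
ren ρ (app M N)  = app (ren ρ M) (ren ρ N)
ren ρ (lett M N) = lett (ren ρ M) (ren (lift ρ) N)

Sub : ℕ → ℕ → Set
Sub n m = Fin n → Tm m

liftS : ∀ {n m} → Sub n m → Sub (suc n) (suc m)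
liftS σ zero    = var zero
liftS σ (suc i) = ren suc (σ i)

sub : ∀ {n m} → Sub n m → Tm n → Tm m
sub σ (var x)    = σ x
sub σ (lam M)    = lam (sub (liftS σ) M)
sub σ (app M N)  = app (sub σ M) (sub σ N)
sub σ (lett M N) = lett (sub σ M) (sub (liftS σ) N)

single : ∀ {n} → Tm n → Sub (suc n) n
single V zero    = V
single V (suc i) = var i

_[_/0] : ∀ {n} → Tm (suc n) → Tm n → Tm n
M [ V /0] = sub (single V) M

data Rule : Set where
  B letv ηlet assoc let1 let2 : Rule

data Top : Rule → ∀ {n} → Tm n → Tm n → Set where
  B     : ∀ {n} (M : Tm (suc n)) (N : Tm n) →
          Top B (app (lam M) N) (lett N M)
  letv  : ∀ {n} (V : Tm n) (M : Tm (suc n)) → IsValue V →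
          Top letv (lett V M) (M [ V /0])
  ηlet  : ∀ {n} (M : Tm n) →
          Top ηlet (lett M (var zero)) M
  assoc : ∀ {n} (M : Tm n) (N : Tm (suc n)) (P : Tm (suc n)) →
          Top assoc (lett (lett M N) P) (lett M (lett N (ren (lift suc) P)))
  let1  : ∀ {n} (M N : Tm n) → NotValue M →
          Top let1 (app M N) (lett M (app (var zero) (ren suc N)))
  let2  : ∀ {n} (V N : Tm n) → IsValue V → NotValue N →
          Top let2 (app V N) (lett N (app (ren suc V) (var zero)))

data _⊢_⟶_ (R : Rule) {n : ℕ} : Tm n → Tm n → Set where
  top   : ∀ {M N} → Top R M N → R ⊢ M ⟶ N
  lamξ  : ∀ {M N : Tm (suc n)} → R ⊢ M ⟶ N → R ⊢ lam M ⟶ lam N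
  appₗ  : ∀ {M M' N} → R ⊢ M ⟶ M' → R ⊢ app M N ⟶ app M' N
  appᵣ  : ∀ {M N N'} → R ⊢ N ⟶ N' → R ⊢ app M N ⟶ app M N'
  letₗ  : ∀ {M M' : Tm n} {N} → R ⊢ M ⟶ M' → R ⊢ lett M N ⟶ lett M' N
  letᵣ  : ∀ {M} {N N' : Tm (suc n)} → R ⊢ N ⟶ N' → R ⊢ lett M N ⟶ lett M N'

mutual
  -- terms M ::= ↑V | C_v(V,c)
  data VTm (n : ℕ) : Set where
    up : VVal n → VTm n
    cv : VVal n → Ctx n → VTm n

  data VVal (n : ℕ) : Set where
    var : Fin n → VVal n
    lam : VTm (suc n) → VVal n

  -- formal contexts c ::= x.M | (W, x.M)
  data Ctx (n : ℕ) : Set where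
    abs  : VTm (suc n) → Ctx n
    pair : VVal n → VTm (suc n) → Ctx n

mutual
  renT : ∀ {n m} → Ren n m → VTm n → VTm m
  renT ρ (up V)   = up (renV ρ V)
  renT ρ (cv V c) = cv (renV ρ V) (renC ρ c)

  renV : ∀ {n m} → Ren n m → VVal n → VVal m
  renV ρ (var x) = var (ρ x)
  renV ρ (lam M) = lam (renT (lift ρ) M)

  renC : ∀ {n m} → Ren n m → Ctx n → Ctx m
  renC ρ (abs M)    = abs (renT (lift ρ) M)
  renC ρ (pair W M) = pair (renV ρ W) (renT (lift ρ) M)

VSub : ℕ → ℕ → Set
VSub n m = Fin n → VVal m

liftVS : ∀ {n m} → VSub n m → VSub (suc n) (suc m)
liftVS σ zero    = var zero
liftVS σ (suc i) = renV suc (σ i)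

mutual
  subT : ∀ {n m} → VSub n m → VTm n → VTm m
  subT σ (up V)   = up (subV σ V)
  subT σ (cv V c) = cv (subV σ V) (subC σ c)

  subV : ∀ {n m} → VSub n m → VVal n → VVal m
  subV σ (var x) = σ x
  subV σ (lam M) = lam (subT (liftVS σ) M)

  subC : ∀ {n m} → VSub n m → Ctx n → Ctx m
  subC σ (abs M)    = abs (subT (liftVS σ) M)
  subC σ (pair W M) = pair (subV σ W) (subT (liftVS σ) M)

vsingle : ∀ {n} → VVal n → VSub (suc n) n
vsingle V zero    = V
vsingle V (suc i) = var i

-- (M : c') and (c : c'); the bound x is chosen fresh for c',
-- i.e. c' is weakened when passing under the binder
mutual
  _∶ₜ_ : ∀ {n} → VTm n → Ctx n → VTm n
  up V   ∶ₜ c' = cv V c'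
  cv V c ∶ₜ c' = cv V (c ∶꜀ c')

  _∶꜀_ : ∀ {n} → Ctx n → Ctx n → Ctx n
  abs M    ∶꜀ c' = abs (M ∶ₜ renC suc c')
  pair W M ∶꜀ c' = pair W (M ∶ₜ renC suc c')

data VTop {n : ℕ} : VTm n → VTm n → Set where
  Bv : ∀ (M : VTm (suc n)) (V : VVal n) (N : VTm (suc n)) →
       VTop (cv (lam M) (pair V N)) (cv V (abs (M ∶ₜ renC suc (abs N))))
  σv : ∀ (V : VVal n) (N : VTm (suc n)) →
       VTop (cv V (abs N)) (subT (vsingle V) N)

mutual
  data _⟶ᵥ_ {n : ℕ} : VTm n → VTm n → Set where
    top  : ∀ {M N} → VTop M N → M ⟶ᵥ N
    upξ  : ∀ {V V'} → V ⟶ᵛ V' → up V ⟶ᵥ up V'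
    cvₗ  : ∀ {V V' c} → V ⟶ᵛ V' → cv V c ⟶ᵥ cv V' c
    cvᵣ  : ∀ {V c c'} → c ⟶꜀ c' → cv V c ⟶ᵥ cv V c'

  data _⟶ᵛ_ {n : ℕ} : VVal n → VVal n → Set where
    lamξ : ∀ {M M' : VTm (suc n)} → M ⟶ᵥ M' → lam M ⟶ᵛ lam M'

  data _⟶꜀_ {n : ℕ} : Ctx n → Ctx n → Set where
    absξ  : ∀ {M M' : VTm (suc n)} → M ⟶ᵥ M' → abs M ⟶꜀ abs M'
    pairₗ : ∀ {W W' M} → W ⟶ᵛ W' → pair W M ⟶꜀ pair W' M
    pairᵣ : ∀ {W} {M M' : VTm (suc n)} → M ⟶ᵥ M' → pair W M ⟶꜀ pair W M'

_⟶ᵥ*_ : ∀ {n} → VTm n → VTm n → Set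
_⟶ᵥ*_ = Star _⟶ᵥ_

-- VFS-translation.  tr M ρ N  is  ((ρ M) ; x.N)  where ρ renames the free
-- variables of M (this environment makes the recursion structural; see the
-- lemmas below which recover the paper's defining equations).

mutual
  tval : ∀ {n m} → Tm (suc n) → Ren n m → VVal m
  tval M ρ = lam (tr M (lift ρ) (up (var zero)))

  tr : ∀ {n m} → Tm n → Ren n m → VTm (suc m) → VTm m
  tr (var x)    ρ N = cv (var (ρ x)) (abs N)
  tr (lam M)    ρ N = cv (tval M ρ) (abs N)
  tr (app (var x) Q)    ρ N = tapp (var (ρ x)) Q ρ N
  tr (app (lam M) Q)    ρ N = tapp (tval M ρ) Q ρ N
  tr (app (app P P') Q) ρ N =
    tr (app P P') ρ (tapp (var zero) Q (suc ∘ ρ) (renT (lift suc) N))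
  tr (app (lett P P') Q) ρ N =
    tr (lett P P') ρ (tapp (var zero) Q (suc ∘ ρ) (renT (lift suc) N))
  tr (lett M P) ρ N = tr M ρ (tr P (lift ρ) (renT (lift suc) N))

  -- tapp h Q ρ N  is  (h (ρ Q) ; x.N) for an already translated head value h
  tapp : ∀ {n m} → VVal m → Tm n → Ren n m → VTm (suc m) → VTm m
  tapp h (var y)    ρ N = cv h (pair (var (ρ y)) N)
  tapp h (lam M)    ρ N = cv h (pair (tval M ρ) N)
  tapp h (app P P') ρ N =
    tr (app P P') ρ (cv (renV suc h) (pair (var zero) (renT (lift suc) N)))
  tapp h (lett P P') ρ N =
    tr (lett P P') ρ (cv (renV suc h) (pair (var zero) (renT (lift suc) N)))

_⨾_ : ∀ {n} → Tm n → VTm (suc n) → VTm n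
M ⨾ N = tr M id N

_° : ∀ {n} {V : Tm n} → IsValue V → VVal n
var x ° = var x
lam M ° = tval M id

_• : ∀ {n} → Tm n → VTm n
M • = M ⨾ up (var zero)

private
  _≗_ : ∀ {n m} → Ren n m → Ren n m → Set
  ρ ≗ ρ' = ∀ i → ρ i ≡ ρ' i

  lift-cong : ∀ {n m} {ρ ρ' : Ren n m} → ρ ≗ ρ' → lift ρ ≗ lift ρ'
  lift-cong e zero    = refl
  lift-cong e (suc i) = cong suc (e i)

  lift-∘ : ∀ {n m k} (ρ : Ren m k) (σ : Ren n m) → _≗_ {suc n} {suc k} (λ i → lift ρ (lift σ i)) (lift (λ i → ρ (σ i)))
  lift-∘ ρ σ zero    = refl
  lift-∘ ρ σ (suc i) = refl

  mutual
    renT-cong : ∀ {n m} {ρ ρ' : Ren n m} → ρ ≗ ρ' → ∀ M → renT ρ M ≡ renT ρ' M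
    renT-cong e (up V)   = cong up (renV-cong e V)
    renT-cong e (cv V c) = cong₂ cv (renV-cong e V) (renC-cong e c)

    renV-cong : ∀ {n m} {ρ ρ' : Ren n m} → ρ ≗ ρ' → ∀ V → renV ρ V ≡ renV ρ' V
    renV-cong e (var x) = cong var (e x)
    renV-cong e (lam M) = cong lam (renT-cong (lift-cong e) M)

    renC-cong : ∀ {n m} {ρ ρ' : Ren n m} → ρ ≗ ρ' → ∀ c → renC ρ c ≡ renC ρ' c
    renC-cong e (abs M)    = cong abs (renT-cong (lift-cong e) M)
    renC-cong e (pair W M) = cong₂ pair (renV-cong e W) (renT-cong (lift-cong e) M)

  mutual
    renT-∘ : ∀ {n m k} (ρ : Ren m k) (σ : Ren n m) M → renT ρ (renT σ M) ≡ renT (ρ ∘ σ) M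
    renT-∘ ρ σ (up V)   = cong up (renV-∘ ρ σ V)
    renT-∘ ρ σ (cv V c) = cong₂ cv (renV-∘ ρ σ V) (renC-∘ ρ σ c)

    renV-∘ : ∀ {n m k} (ρ : Ren m k) (σ : Ren n m) V → renV ρ (renV σ V) ≡ renV (ρ ∘ σ) V
    renV-∘ ρ σ (var x) = refl
    renV-∘ ρ σ (lam M) = cong lam (trans (renT-∘ (lift ρ) (lift σ) M) (renT-cong (lift-∘ ρ σ) M))

    renC-∘ : ∀ {n m k} (ρ : Ren m k) (σ : Ren n m) c → renC ρ (renC σ c) ≡ renC (ρ ∘ σ) c
    renC-∘ ρ σ (abs M) = cong abs (trans (renT-∘ (lift ρ) (lift σ) M) (renT-cong (lift-∘ ρ σ) M))
    renC-∘ ρ σ (pair W M) = cong₂ pair (renV-∘ ρ σ W)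
      (trans (renT-∘ (lift ρ) (lift σ) M) (renT-cong (lift-∘ ρ σ) M))

  wk-comm : ∀ {n m} (ρ : Ren n m) (N : VTm (suc n)) →
            renT (lift (lift ρ)) (renT (lift suc) N) ≡ renT (lift suc) (renT (lift ρ) N)
  wk-comm {n} {m} ρ N = trans (renT-∘ (lift (lift ρ)) (lift suc) N)
    (trans (renT-cong e N) (sym (renT-∘ (lift suc) (lift ρ) N)))
    where
      e : _≗_ {suc n} {suc (suc m)} (λ i → lift (lift ρ) (lift suc i)) (λ i → lift suc (lift ρ i))
      e zero    = refl
      e (suc i) = refl

  mutual
    tr-cong : ∀ {n m} {ρ ρ' : Ren n m} → ρ ≗ ρ' → ∀ M N → tr M ρ N ≡ tr M ρ' N
    tr-cong e (var x) N = cong (λ y → cv (var y) (abs N)) (e x)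
    tr-cong e (lam M) N = cong (λ v → cv v (abs N)) (tval-cong e M)
    tr-cong e (app (var x) Q) N =
      trans (cong (λ y → tapp (var y) Q _ N) (e x)) (tapp-cong e _ Q N)
    tr-cong {ρ = ρ} {ρ'} e (app (lam M) Q) N =
      trans (cong (λ v → tapp v Q ρ N) (tval-cong e M)) (tapp-cong e (tval M ρ') Q N)
    tr-cong e (app (app P P') Q) N =
      trans (tr-cong e (app P P') _) (cong (tr (app P P') _) (tapp-cong (cong suc ∘ e) _ Q _))
    tr-cong e (app (lett P P') Q) N =
      trans (tr-cong e (lett P P') _) (cong (tr (lett P P') _) (tapp-cong (cong suc ∘ e) _ Q _))
    tr-cong e (lett M P) N =
      trans (tr-cong e M _) (cong (tr M _) (tr-cong (lift-cong e) P _))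

    tval-cong : ∀ {n m} {ρ ρ' : Ren n m} → ρ ≗ ρ' → ∀ M → tval M ρ ≡ tval M ρ'
    tval-cong e M = cong lam (tr-cong (lift-cong e) M _)

    tapp-cong : ∀ {n m} {ρ ρ' : Ren n m} → ρ ≗ ρ' → ∀ h Q N → tapp h Q ρ N ≡ tapp h Q ρ' N
    tapp-cong e h (var y) N = cong (λ y → cv h (pair (var y) N)) (e y)
    tapp-cong e h (lam M) N = cong (λ v → cv h (pair v N)) (tval-cong e M)
    tapp-cong e h (app P P') N = tr-cong e (app P P') _
    tapp-cong e h (lett P P') N = tr-cong e (lett P P') _

  mutual
    tr-ren : ∀ {n m k} (σ : Ren n m) (ρ : Ren m k) M N → tr (ren σ M) ρ N ≡ tr M (ρ ∘ σ) N
    tr-ren σ ρ (var x) N = refl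
    tr-ren σ ρ (lam M) N = cong (λ v → cv v (abs N)) (tval-ren σ ρ M)
    tr-ren σ ρ (app (var x) Q) N = tapp-ren σ ρ _ Q N
    tr-ren σ ρ (app (lam M) Q) N =
      trans (cong (λ v → tapp v (ren σ Q) ρ N) (tval-ren σ ρ M)) (tapp-ren σ ρ _ Q N)
    tr-ren σ ρ (app (app P P') Q) N =
      trans (tr-ren σ ρ (app P P') _) (cong (tr (app P P') _) (tapp-ren σ (suc ∘ ρ) _ Q _))
    tr-ren σ ρ (app (lett P P') Q) N =
      trans (tr-ren σ ρ (lett P P') _) (cong (tr (lett P P') _) (tapp-ren σ (suc ∘ ρ) _ Q _))
    tr-ren σ ρ (lett M P) N =
      trans (tr-ren σ ρ M _)
        (cong (tr M _) (trans (tr-ren (lift σ) (lift ρ) P _) (tr-cong (lift-∘ ρ σ) P _)))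

    tval-ren : ∀ {n m k} (σ : Ren n m) (ρ : Ren m k) M → tval (ren (lift σ) M) ρ ≡ tval M (ρ ∘ σ)
    tval-ren σ ρ M = cong lam (trans (tr-ren (lift σ) (lift ρ) M _) (tr-cong (lift-∘ ρ σ) M _))

    tapp-ren : ∀ {n m k} (σ : Ren n m) (ρ : Ren m k) h Q N →
               tapp h (ren σ Q) ρ N ≡ tapp h Q (ρ ∘ σ) N
    tapp-ren σ ρ h (var y) N = refl
    tapp-ren σ ρ h (lam M) N = cong (λ v → cv h (pair v N)) (tval-ren σ ρ M)
    tapp-ren σ ρ h (app P P') N = tr-ren σ ρ (app P P') _
    tapp-ren σ ρ h (lett P P') N = tr-ren σ ρ (lett P P') _

  mutual
    ren-tr : ∀ {n m k} (ρ' : Ren m k) (ρ : Ren n m) M N →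
             renT ρ' (tr M ρ N) ≡ tr M (ρ' ∘ ρ) (renT (lift ρ') N)
    ren-tr ρ' ρ (var x) N = refl
    ren-tr ρ' ρ (lam M) N = cong (λ v → cv v (abs (renT (lift ρ') N))) (ren-tval ρ' ρ M)
    ren-tr ρ' ρ (app (var x) Q) N = ren-tapp ρ' ρ _ Q N
    ren-tr ρ' ρ (app (lam M) Q) N =
      trans (ren-tapp ρ' ρ _ Q N) (cong (λ v → tapp v Q (ρ' ∘ ρ) (renT (lift ρ') N)) (ren-tval ρ' ρ M))
    ren-tr ρ' ρ (app (app P P') Q) N =
      trans (ren-tr ρ' ρ (app P P') _)
        (cong (tr (app P P') _)
          (trans (ren-tapp (lift ρ') (suc ∘ ρ) _ Q _)
                 (cong (tapp (var zero) Q _) (wk-comm ρ' N))))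
    ren-tr ρ' ρ (app (lett P P') Q) N =
      trans (ren-tr ρ' ρ (lett P P') _)
        (cong (tr (lett P P') _)
          (trans (ren-tapp (lift ρ') (suc ∘ ρ) _ Q _)
                 (cong (tapp (var zero) Q _) (wk-comm ρ' N))))
    ren-tr ρ' ρ (lett M P) N =
      trans (ren-tr ρ' ρ M _)
        (cong (tr M _)
          (trans (ren-tr (lift ρ') (lift ρ) P _)
            (trans (tr-cong (lift-∘ ρ' ρ) P _) (cong (tr P _) (wk-comm ρ' N)))))

    ren-tval : ∀ {n m k} (ρ' : Ren m k) (ρ : Ren n m) M → renV ρ' (tval M ρ) ≡ tval M (ρ' ∘ ρ)
    ren-tval ρ' ρ M = cong lam (trans (ren-tr (lift ρ') (lift ρ) M _) (tr-cong (lift-∘ ρ' ρ) M _))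

    ren-tapp : ∀ {n m k} (ρ' : Ren m k) (ρ : Ren n m) h Q N →
               renT ρ' (tapp h Q ρ N) ≡ tapp (renV ρ' h) Q (ρ' ∘ ρ) (renT (lift ρ') N)
    ren-tapp ρ' ρ h (var y) N = refl
    ren-tapp ρ' ρ h (lam M) N =
      cong (λ v → cv (renV ρ' h) (pair v (renT (lift ρ') N))) (ren-tval ρ' ρ M)
    ren-tapp ρ' ρ h (app P P') N =
      trans (ren-tr ρ' ρ (app P P') _)
        (cong (λ z → tr (app P P') _ (cv z (pair (var zero) _)))
          (trans (renV-∘ _ _ h) (sym (renV-∘ _ _ h))) ⟨≡⟩ cong (λ z → tr (app P P') _ (cv _ (pair (var zero) z))) (wk-comm ρ' N))
      where
        _⟨≡⟩_ : ∀ {A : Set} {a b c : A} → a ≡ b → b ≡ c → a ≡ c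
        _⟨≡⟩_ = trans
    ren-tapp ρ' ρ h (lett P P') N =
      trans (ren-tr ρ' ρ (lett P P') _)
        (trans (cong (λ z → tr (lett P P') _ (cv z (pair (var zero) _)))
                 (trans (renV-∘ _ _ h) (sym (renV-∘ _ _ h))))
               (cong (λ z → tr (lett P P') _ (cv _ (pair (var zero) z))) (wk-comm ρ' N)))

⨾-val : ∀ {n} {V : Tm n} (v : IsValue V) (N : VTm (suc n)) → (V ⨾ N) ≡ cv (v °) (abs N)
⨾-val (var x) N = refl
⨾-val (lam M) N = refl

⨾-app₁ : ∀ {n} (P Q : Tm n) (N : VTm (suc n)) → NotValue P →
         (app P Q ⨾ N) ≡ (P ⨾ (app (var zero) (ren suc Q) ⨾ renT (lift suc) N))
⨾-app₁ (var x) Q N nv = Data.Empty.⊥-elim (nv (var x)) where import Data.Empty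
⨾-app₁ (lam M) Q N nv = Data.Empty.⊥-elim (nv (lam M)) where import Data.Empty
⨾-app₁ (app P P') Q N nv = cong (tr (app P P') id) (sym (tapp-ren suc id _ Q _))
⨾-app₁ (lett P P') Q N nv = cong (tr (lett P P') id) (sym (tapp-ren suc id _ Q _))

⨾-app₂ : ∀ {n} (V Q : Tm n) (N : VTm (suc n)) → IsValue V → NotValue Q →
         (app V Q ⨾ N) ≡ (Q ⨾ (app (ren suc V) (var zero) ⨾ renT (lift suc) N))
⨾-app₂ V (var x) N v nv = Data.Empty.⊥-elim (nv (var x)) where import Data.Empty
⨾-app₂ V (lam M) N v nv = Data.Empty.⊥-elim (nv (lam M)) where import Data.Empty
⨾-app₂ (var y) (app P P') N v nv = refl
⨾-app₂ (var y) (lett P P') N v nv = refl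
⨾-app₂ (lam M) (app P P') N v nv =
  cong (λ h → tr (app P P') id (cv h (pair (var zero) (renT (lift suc) N))))
    (trans (ren-tval suc id M) (sym (tval-ren suc id M)))
⨾-app₂ (lam M) (lett P P') N v nv =
  cong (λ h → tr (lett P P') id (cv h (pair (var zero) (renT (lift suc) N))))
    (trans (ren-tval suc id M) (sym (tval-ren suc id M)))

⨾-app₃ : ∀ {n} {V W : Tm n} (v : IsValue V) (w : IsValue W) (N : VTm (suc n)) →
         (app V W ⨾ N) ≡ cv (v °) (pair (w °) N)
⨾-app₃ (var x) (var y) N = refl
⨾-app₃ (var x) (lam M) N = refl
⨾-app₃ (lam P) (var y) N = refl
⨾-app₃ (lam P) (lam M) N = refl

⨾-let : ∀ {n} (M : Tm n) (P : Tm (suc n)) (N : VTm (suc n)) →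
        (lett M P ⨾ N) ≡ (M ⨾ (P ⨾ renT (lift suc) N))
⨾-let M P N = cong (tr M id) (tr-cong (λ { zero → refl ; (suc i) → refl }) P _)

°-lam : ∀ {n} (M : Tm (suc n)) → lam M ° ≡ lam (M •)
°-lam M = cong lam (tr-cong (λ { zero → refl ; (suc i) → refl }) M _)

module Submission where

-- The translation is a CPS-style translation: (M ; x.N) evaluates M and passes its value to
-- the continuation x.N, sequentialising applications.  The administrative rules let₁, let₂ and
-- assoc only restate that sequentialisation, so both sides have literally the same image.  A
-- B-redex (λx.M)N becomes a B_v-redex; the colon operation (M• : y.K) then plugs K into the
-- final continuation x.↑x of M•, leaving an administrative σ_v-redex that is contracted at
-- once.  A let_v-redex becomes a σ_v-redex, by the substitution lemma (values translate to
-- values), and an η_let-redex leaves the σ_v-redex C_v(x, y.K) in the continuation.  Reduction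
-- under a constructor is simulated because the continuation is a parameter of the translation;
-- the only subtlety is a non-value operand that reduces to a value, which costs one extra σ_v
-- step.

open import Defs
open import Data.Nat using (ℕ; zero; suc)
open import Data.Product using (_×_; _,_)
open import Data.Sum using (_⊎_; inj₁; inj₂)
open import Data.Empty using (⊥; ⊥-elim)
open import Data.Fin using (Fin; zero; suc)
open import Function using (id; _∘_)
open import Relation.Nullary using (Dec; yes; no)
open import Relation.Binary.PropositionalEquality
  using (_≡_; _≗_; refl; cong; cong₂; sym; trans; subst; module ≡-Reasoning)
open import Relation.Binary.Construct.Closure.ReflexiveTransitive
  using (Star; _◅_; _◅◅_; gmap)
open import Relation.Binary.Construct.Closure.ReflexiveTransitive.Properties
  using (reflexive; module StarReasoning)

-- Renaming and substitution in VFS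

lift-cong : ∀ {n m} {ρ ρ' : Ren n m} → ρ ≗ ρ' → lift ρ ≗ lift ρ'
lift-cong e zero    = refl
lift-cong e (suc i) = cong suc (e i)

lift-∘ : ∀ {n m k} (ρ : Ren m k) (σ : Ren n m) → lift ρ ∘ lift σ ≗ lift (ρ ∘ σ)
lift-∘ ρ σ zero    = refl
lift-∘ ρ σ (suc i) = refl

mutual
  renT-cong : ∀ {n m} {ρ ρ' : Ren n m} → ρ ≗ ρ' → ∀ M → renT ρ M ≡ renT ρ' M
  renT-cong e (up V)   = cong up (renV-cong e V)
  renT-cong e (cv V c) = cong₂ cv (renV-cong e V) (renC-cong e c)

  renV-cong : ∀ {n m} {ρ ρ' : Ren n m} → ρ ≗ ρ' → ∀ V → renV ρ V ≡ renV ρ' V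
  renV-cong e (var x) = cong var (e x)
  renV-cong e (lam M) = cong lam (renT-cong (lift-cong e) M)

  renC-cong : ∀ {n m} {ρ ρ' : Ren n m} → ρ ≗ ρ' → ∀ c → renC ρ c ≡ renC ρ' c
  renC-cong e (abs M)    = cong abs (renT-cong (lift-cong e) M)
  renC-cong e (pair W M) = cong₂ pair (renV-cong e W) (renT-cong (lift-cong e) M)

mutual
  renT-∘ : ∀ {n m k} (ρ : Ren m k) (σ : Ren n m) M → renT ρ (renT σ M) ≡ renT (ρ ∘ σ) M
  renT-∘ ρ σ (up V)   = cong up (renV-∘ ρ σ V)
  renT-∘ ρ σ (cv V c) = cong₂ cv (renV-∘ ρ σ V) (renC-∘ ρ σ c)

  renV-∘ : ∀ {n m k} (ρ : Ren m k) (σ : Ren n m) V → renV ρ (renV σ V) ≡ renV (ρ ∘ σ) V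
  renV-∘ ρ σ (var x) = refl
  renV-∘ ρ σ (lam M) = cong lam (renT-lift-∘ ρ σ M)

  renC-∘ : ∀ {n m k} (ρ : Ren m k) (σ : Ren n m) c → renC ρ (renC σ c) ≡ renC (ρ ∘ σ) c
  renC-∘ ρ σ (abs M)    = cong abs (renT-lift-∘ ρ σ M)
  renC-∘ ρ σ (pair W M) = cong₂ pair (renV-∘ ρ σ W) (renT-lift-∘ ρ σ M)

  renT-lift-∘ : ∀ {n m k} (ρ : Ren m k) (σ : Ren n m) M →
                renT (lift ρ) (renT (lift σ) M) ≡ renT (lift (ρ ∘ σ)) M
  renT-lift-∘ ρ σ M = trans (renT-∘ (lift ρ) (lift σ) M) (renT-cong (lift-∘ ρ σ) M)

renT-weaken-comm : ∀ {n m} (ρ : Ren n m) (N : VTm (suc n)) →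
                   renT (lift (lift ρ)) (renT (lift suc) N) ≡ renT (lift suc) (renT (lift ρ) N)
renT-weaken-comm ρ N = trans (renT-lift-∘ (lift ρ) suc N) (sym (renT-lift-∘ suc ρ N))

renC-weaken-comm : ∀ {n m} (ρ : Ren n m) c → renC (lift ρ) (renC suc c) ≡ renC suc (renC ρ c)
renC-weaken-comm ρ c = trans (renC-∘ (lift ρ) suc c) (sym (renC-∘ suc ρ c))

liftVS-cong : ∀ {n m} {σ σ' : VSub n m} → σ ≗ σ' → liftVS σ ≗ liftVS σ'
liftVS-cong e zero    = refl
liftVS-cong e (suc i) = cong (renV suc) (e i)

mutual
  subT-cong : ∀ {n m} {σ σ' : VSub n m} → σ ≗ σ' → ∀ M → subT σ M ≡ subT σ' M
  subT-cong e (up V)   = cong up (subV-cong e V)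
  subT-cong e (cv V c) = cong₂ cv (subV-cong e V) (subC-cong e c)

  subV-cong : ∀ {n m} {σ σ' : VSub n m} → σ ≗ σ' → ∀ V → subV σ V ≡ subV σ' V
  subV-cong e (var x) = e x
  subV-cong e (lam M) = cong lam (subT-cong (liftVS-cong e) M)

  subC-cong : ∀ {n m} {σ σ' : VSub n m} → σ ≗ σ' → ∀ c → subC σ c ≡ subC σ' c
  subC-cong e (abs M)    = cong abs (subT-cong (liftVS-cong e) M)
  subC-cong e (pair W M) = cong₂ pair (subV-cong e W) (subT-cong (liftVS-cong e) M)

liftVS-id : ∀ {n} {σ : VSub n n} → σ ≗ var → liftVS σ ≗ var
liftVS-id e zero    = refl
liftVS-id e (suc i) = cong (renV suc) (e i)

mutual
  subT-id : ∀ {n} {σ : VSub n n} → σ ≗ var → ∀ M → subT σ M ≡ M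
  subT-id e (up V)   = cong up (subV-id e V)
  subT-id e (cv V c) = cong₂ cv (subV-id e V) (subC-id e c)

  subV-id : ∀ {n} {σ : VSub n n} → σ ≗ var → ∀ V → subV σ V ≡ V
  subV-id e (var x) = e x
  subV-id e (lam M) = cong lam (subT-id (liftVS-id e) M)

  subC-id : ∀ {n} {σ : VSub n n} → σ ≗ var → ∀ c → subC σ c ≡ c
  subC-id e (abs M)    = cong abs (subT-id (liftVS-id e) M)
  subC-id e (pair W M) = cong₂ pair (subV-id e W) (subT-id (liftVS-id e) M)

liftVS-lift : ∀ {n m k} (σ : VSub m k) (ρ : Ren n m) → liftVS σ ∘ lift ρ ≗ liftVS (σ ∘ ρ)
liftVS-lift σ ρ zero    = refl
liftVS-lift σ ρ (suc i) = refl

mutual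
  subT-renT : ∀ {n m k} (σ : VSub m k) (ρ : Ren n m) M → subT σ (renT ρ M) ≡ subT (σ ∘ ρ) M
  subT-renT σ ρ (up V)   = cong up (subV-renV σ ρ V)
  subT-renT σ ρ (cv V c) = cong₂ cv (subV-renV σ ρ V) (subC-renC σ ρ c)

  subV-renV : ∀ {n m k} (σ : VSub m k) (ρ : Ren n m) V → subV σ (renV ρ V) ≡ subV (σ ∘ ρ) V
  subV-renV σ ρ (var x) = refl
  subV-renV σ ρ (lam M) = cong lam (subT-lift-renT σ ρ M)

  subC-renC : ∀ {n m k} (σ : VSub m k) (ρ : Ren n m) c → subC σ (renC ρ c) ≡ subC (σ ∘ ρ) c
  subC-renC σ ρ (abs M)    = cong abs (subT-lift-renT σ ρ M)
  subC-renC σ ρ (pair W M) = cong₂ pair (subV-renV σ ρ W) (subT-lift-renT σ ρ M)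

  subT-lift-renT : ∀ {n m k} (σ : VSub m k) (ρ : Ren n m) M →
                   subT (liftVS σ) (renT (lift ρ) M) ≡ subT (liftVS (σ ∘ ρ)) M
  subT-lift-renT σ ρ M = trans (subT-renT (liftVS σ) (lift ρ) M) (subT-cong (liftVS-lift σ ρ) M)

renV-liftVS : ∀ {n m k} (ρ : Ren m k) (σ : VSub n m) →
              renV (lift ρ) ∘ liftVS σ ≗ liftVS (renV ρ ∘ σ)
renV-liftVS ρ σ zero    = refl
renV-liftVS ρ σ (suc i) = trans (renV-∘ (lift ρ) suc (σ i)) (sym (renV-∘ suc ρ (σ i)))

mutual
  renT-subT : ∀ {n m k} (ρ : Ren m k) (σ : VSub n m) M → renT ρ (subT σ M) ≡ subT (renV ρ ∘ σ) M
  renT-subT ρ σ (up V)   = cong up (renV-subV ρ σ V)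
  renT-subT ρ σ (cv V c) = cong₂ cv (renV-subV ρ σ V) (renC-subC ρ σ c)

  renV-subV : ∀ {n m k} (ρ : Ren m k) (σ : VSub n m) V → renV ρ (subV σ V) ≡ subV (renV ρ ∘ σ) V
  renV-subV ρ σ (var x) = refl
  renV-subV ρ σ (lam M) = cong lam (renT-lift-subT ρ σ M)

  renC-subC : ∀ {n m k} (ρ : Ren m k) (σ : VSub n m) c → renC ρ (subC σ c) ≡ subC (renV ρ ∘ σ) c
  renC-subC ρ σ (abs M)    = cong abs (renT-lift-subT ρ σ M)
  renC-subC ρ σ (pair W M) = cong₂ pair (renV-subV ρ σ W) (renT-lift-subT ρ σ M)

  renT-lift-subT : ∀ {n m k} (ρ : Ren m k) (σ : VSub n m) M →
                   renT (lift ρ) (subT (liftVS σ) M) ≡ subT (liftVS (renV ρ ∘ σ)) M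
  renT-lift-subT ρ σ M = trans (renT-subT (lift ρ) (liftVS σ) M) (subT-cong (renV-liftVS ρ σ) M)

subT-renT-id : ∀ {n m} {σ : VSub m n} {ρ : Ren n m} → σ ∘ ρ ≗ var → ∀ M → subT σ (renT ρ M) ≡ M
subT-renT-id {σ = σ} {ρ} e M = trans (subT-renT σ ρ M) (subT-id e M)

subV-weaken : ∀ {m k} (σ : VSub m k) V → subV (liftVS σ) (renV suc V) ≡ renV suc (subV σ V)
subV-weaken σ V = trans (subV-renV (liftVS σ) suc V) (sym (renV-subV suc σ V))

subT-weaken-comm : ∀ {m k} (σ : VSub m k) K →
                   subT (liftVS (liftVS σ)) (renT (lift suc) K)
                   ≡ renT (lift suc) (subT (liftVS σ) K)
subT-weaken-comm σ K = trans (subT-lift-renT (liftVS σ) suc K) (sym (renT-lift-subT suc σ K))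

mutual
  renT-∶ₜ : ∀ {n m} (ρ : Ren n m) M c → renT ρ (M ∶ₜ c) ≡ (renT ρ M ∶ₜ renC ρ c)
  renT-∶ₜ ρ (up V)    c = refl
  renT-∶ₜ ρ (cv V c₀) c = cong (cv (renV ρ V)) (renC-∶꜀ ρ c₀ c)

  renC-∶꜀ : ∀ {n m} (ρ : Ren n m) c₀ c → renC ρ (c₀ ∶꜀ c) ≡ (renC ρ c₀ ∶꜀ renC ρ c)
  renC-∶꜀ ρ (abs M)    c = cong abs (renT-lift-∶ₜ ρ M c)
  renC-∶꜀ ρ (pair W M) c = cong (pair (renV ρ W)) (renT-lift-∶ₜ ρ M c)

  renT-lift-∶ₜ : ∀ {n m} (ρ : Ren n m) M c →
                 renT (lift ρ) (M ∶ₜ renC suc c) ≡ (renT (lift ρ) M ∶ₜ renC suc (renC ρ c))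
  renT-lift-∶ₜ ρ M c =
    trans (renT-∶ₜ (lift ρ) M (renC suc c)) (cong (renT (lift ρ) M ∶ₜ_) (renC-weaken-comm ρ c))

VTop-renT : ∀ {n m} (ρ : Ren n m) {M M'} → VTop M M' → renT ρ M ⟶ᵥ renT ρ M'
VTop-renT ρ (Bv M V N) =
  subst (λ z → renT ρ (cv (lam M) (pair V N)) ⟶ᵥ cv (renV ρ V) (abs z))
        (sym (renT-lift-∶ₜ ρ M (abs N))) (top (Bv _ _ _))
VTop-renT ρ (σv V N) =
  subst (renT ρ (cv V (abs N)) ⟶ᵥ_) singleton-renT (top (σv _ _))
  where
    vsingle-lift : vsingle (renV ρ V) ∘ lift ρ ≗ renV ρ ∘ vsingle V
    vsingle-lift zero    = refl
    vsingle-lift (suc i) = refl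

    singleton-renT : subT (vsingle (renV ρ V)) (renT (lift ρ) N) ≡ renT ρ (subT (vsingle V) N)
    singleton-renT = trans (subT-renT _ (lift ρ) N)
      (trans (subT-cong vsingle-lift N) (sym (renT-subT ρ (vsingle V) N)))

mutual
  ⟶ᵥ-renT : ∀ {n m} (ρ : Ren n m) {M M'} → M ⟶ᵥ M' → renT ρ M ⟶ᵥ renT ρ M'
  ⟶ᵥ-renT ρ (top t) = VTop-renT ρ t
  ⟶ᵥ-renT ρ (upξ s) = upξ (⟶ᵛ-renV ρ s)
  ⟶ᵥ-renT ρ (cvₗ s) = cvₗ (⟶ᵛ-renV ρ s)
  ⟶ᵥ-renT ρ (cvᵣ s) = cvᵣ (⟶꜀-renC ρ s)

  ⟶ᵛ-renV : ∀ {n m} (ρ : Ren n m) {V V'} → V ⟶ᵛ V' → renV ρ V ⟶ᵛ renV ρ V'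
  ⟶ᵛ-renV ρ (lamξ s) = lamξ (⟶ᵥ-renT (lift ρ) s)

  ⟶꜀-renC : ∀ {n m} (ρ : Ren n m) {c c'} → c ⟶꜀ c' → renC ρ c ⟶꜀ renC ρ c'
  ⟶꜀-renC ρ (absξ s)  = absξ (⟶ᵥ-renT (lift ρ) s)
  ⟶꜀-renC ρ (pairₗ s) = pairₗ (⟶ᵛ-renV ρ s)
  ⟶꜀-renC ρ (pairᵣ s) = pairᵣ (⟶ᵥ-renT (lift ρ) s)

_⟶ᵛ*_ : ∀ {n} → VVal n → VVal n → Set
_⟶ᵛ*_ = Star _⟶ᵛ_

ren-value : ∀ {n m} (ρ : Ren n m) {V : Tm n} → IsValue V → IsValue (ren ρ V)
ren-value ρ (var x) = var (ρ x)
ren-value ρ (lam M) = lam (ren (lift ρ) M)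

isValue? : ∀ {n} (M : Tm n) → Dec (IsValue M)
isValue? (var x)    = yes (var x)
isValue? (lam M)    = yes (lam M)
isValue? (app M N)  = no λ ()
isValue? (lett M N) = no λ ()

liftS-id : ∀ {n} {σ : Sub n n} → σ ≗ var → liftS σ ≗ var
liftS-id e zero    = refl
liftS-id e (suc i) = cong (ren suc) (e i)

sub-id : ∀ {n} {σ : Sub n n} → σ ≗ var → ∀ M → sub σ M ≡ M
sub-id e (var x)    = e x
sub-id e (lam M)    = cong lam (sub-id (liftS-id e) M)
sub-id e (app M N)  = cong₂ app (sub-id e M) (sub-id e N)
sub-id e (lett M N) = cong₂ lett (sub-id e M) (sub-id (liftS-id e) N)

var-irreducible : ∀ {R n} {x : Fin n} {M} → R ⊢ var x ⟶ M → ⊥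
var-irreducible (top ())

-- The continuations m.(m Q ; x.K) and n.(h n ; x.K) through which the translation
-- sequentialises a non-value head, resp. argument, of an application

headCont : ∀ {n m} → Tm n → Ren n m → VTm (suc m) → VTm (suc m)
headCont Q ρ K = tapp (var zero) Q (suc ∘ ρ) (renT (lift suc) K)

argCont : ∀ {m} → VVal m → VTm (suc m) → VTm (suc m)
argCont h K = cv (renV suc h) (pair (var zero) (renT (lift suc) K))

-- Functoriality of the translation

renV-weaken-comm : ∀ {n m} (ρ : Ren n m) V → renV (lift ρ) (renV suc V) ≡ renV suc (renV ρ V)
renV-weaken-comm ρ V = trans (renV-∘ (lift ρ) suc V) (sym (renV-∘ suc ρ V))

renT-argCont : ∀ {m k} (ρ' : Ren m k) h N →
               renT (lift ρ') (argCont h N) ≡ argCont (renV ρ' h) (renT (lift ρ') N)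
renT-argCont ρ' h N =
  cong₂ (λ a b → cv a (pair (var zero) b)) (renV-weaken-comm ρ' h) (renT-weaken-comm ρ' N)

mutual
  tr-cong : ∀ {n m} {ρ ρ' : Ren n m} → ρ ≗ ρ' → ∀ M N → tr M ρ N ≡ tr M ρ' N
  tr-cong e (var x) N = cong (λ y → cv (var y) (abs N)) (e x)
  tr-cong e (lam M) N = cong (λ v → cv v (abs N)) (tval-cong e M)
  tr-cong e (app (var x) Q) N =
    trans (cong (λ y → tapp (var y) Q _ N) (e x)) (tapp-cong e _ Q N)
  tr-cong {ρ = ρ} {ρ'} e (app (lam M) Q) N =
    trans (cong (λ v → tapp v Q ρ N) (tval-cong e M)) (tapp-cong e (tval M ρ') Q N)
  tr-cong e (app (app P P') Q) N =
    trans (tr-cong e (app P P') _) (cong (tr (app P P') _) (tapp-cong (cong suc ∘ e) _ Q _))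
  tr-cong e (app (lett P P') Q) N =
    trans (tr-cong e (lett P P') _) (cong (tr (lett P P') _) (tapp-cong (cong suc ∘ e) _ Q _))
  tr-cong e (lett M P) N =
    trans (tr-cong e M _) (cong (tr M _) (tr-cong (lift-cong e) P _))

  tval-cong : ∀ {n m} {ρ ρ' : Ren n m} → ρ ≗ ρ' → ∀ M → tval M ρ ≡ tval M ρ'
  tval-cong e M = cong lam (tr-cong (lift-cong e) M _)

  tapp-cong : ∀ {n m} {ρ ρ' : Ren n m} → ρ ≗ ρ' → ∀ h Q N → tapp h Q ρ N ≡ tapp h Q ρ' N
  tapp-cong e h (var y)     N = cong (λ y → cv h (pair (var y) N)) (e y)
  tapp-cong e h (lam M)     N = cong (λ v → cv h (pair v N)) (tval-cong e M)
  tapp-cong e h (app P P')  N = tr-cong e (app P P') _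
  tapp-cong e h (lett P P') N = tr-cong e (lett P P') _

mutual
  tr-ren : ∀ {n m k} (σ : Ren n m) (ρ : Ren m k) M N → tr (ren σ M) ρ N ≡ tr M (ρ ∘ σ) N
  tr-ren σ ρ (var x) N = refl
  tr-ren σ ρ (lam M) N = cong (λ v → cv v (abs N)) (tval-ren σ ρ M)
  tr-ren σ ρ (app (var x) Q) N = tapp-ren σ ρ _ Q N
  tr-ren σ ρ (app (lam M) Q) N =
    trans (cong (λ v → tapp v (ren σ Q) ρ N) (tval-ren σ ρ M)) (tapp-ren σ ρ _ Q N)
  tr-ren σ ρ (app (app P P') Q) N =
    trans (tr-ren σ ρ (app P P') _) (cong (tr (app P P') _) (tapp-ren σ (suc ∘ ρ) _ Q _))
  tr-ren σ ρ (app (lett P P') Q) N =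
    trans (tr-ren σ ρ (lett P P') _) (cong (tr (lett P P') _) (tapp-ren σ (suc ∘ ρ) _ Q _))
  tr-ren σ ρ (lett M P) N =
    trans (tr-ren σ ρ M _)
      (cong (tr M _) (trans (tr-ren (lift σ) (lift ρ) P _) (tr-cong (lift-∘ ρ σ) P _)))

  tval-ren : ∀ {n m k} (σ : Ren n m) (ρ : Ren m k) M → tval (ren (lift σ) M) ρ ≡ tval M (ρ ∘ σ)
  tval-ren σ ρ M = cong lam (trans (tr-ren (lift σ) (lift ρ) M _) (tr-cong (lift-∘ ρ σ) M _))

  tapp-ren : ∀ {n m k} (σ : Ren n m) (ρ : Ren m k) h Q N →
             tapp h (ren σ Q) ρ N ≡ tapp h Q (ρ ∘ σ) N
  tapp-ren σ ρ h (var y)     N = refl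
  tapp-ren σ ρ h (lam M)     N = cong (λ v → cv h (pair v N)) (tval-ren σ ρ M)
  tapp-ren σ ρ h (app P P')  N = tr-ren σ ρ (app P P') _
  tapp-ren σ ρ h (lett P P') N = tr-ren σ ρ (lett P P') _

mutual
  renT-tr : ∀ {n m k} (ρ' : Ren m k) (ρ : Ren n m) M N →
            renT ρ' (tr M ρ N) ≡ tr M (ρ' ∘ ρ) (renT (lift ρ') N)
  renT-tr ρ' ρ (var x) N = refl
  renT-tr ρ' ρ (lam M) N = cong (λ v → cv v (abs (renT (lift ρ') N))) (renV-tval ρ' ρ M)
  renT-tr ρ' ρ (app (var x) Q) N = renT-tapp ρ' ρ _ Q N
  renT-tr ρ' ρ (app (lam M) Q) N =
    trans (renT-tapp ρ' ρ _ Q N)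
          (cong (λ v → tapp v Q (ρ' ∘ ρ) (renT (lift ρ') N)) (renV-tval ρ' ρ M))
  renT-tr ρ' ρ (app (app P P') Q) N =
    trans (renT-tr ρ' ρ (app P P') _) (cong (tr (app P P') _) (renT-headCont ρ' ρ Q N))
  renT-tr ρ' ρ (app (lett P P') Q) N =
    trans (renT-tr ρ' ρ (lett P P') _) (cong (tr (lett P P') _) (renT-headCont ρ' ρ Q N))
  renT-tr ρ' ρ (lett M P) N =
    trans (renT-tr ρ' ρ M _)
      (cong (tr M _)
        (trans (renT-tr (lift ρ') (lift ρ) P _)
          (trans (tr-cong (lift-∘ ρ' ρ) P _) (cong (tr P _) (renT-weaken-comm ρ' N)))))

  renV-tval : ∀ {n m k} (ρ' : Ren m k) (ρ : Ren n m) M → renV ρ' (tval M ρ) ≡ tval M (ρ' ∘ ρ)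
  renV-tval ρ' ρ M =
    cong lam (trans (renT-tr (lift ρ') (lift ρ) M _) (tr-cong (lift-∘ ρ' ρ) M _))

  renT-tapp : ∀ {n m k} (ρ' : Ren m k) (ρ : Ren n m) h Q N →
              renT ρ' (tapp h Q ρ N) ≡ tapp (renV ρ' h) Q (ρ' ∘ ρ) (renT (lift ρ') N)
  renT-tapp ρ' ρ h (var y) N = refl
  renT-tapp ρ' ρ h (lam M) N =
    cong (λ v → cv (renV ρ' h) (pair v (renT (lift ρ') N))) (renV-tval ρ' ρ M)
  renT-tapp ρ' ρ h (app P P') N =
    trans (renT-tr ρ' ρ (app P P') _) (cong (tr (app P P') _) (renT-argCont ρ' h N))
  renT-tapp ρ' ρ h (lett P P') N =
    trans (renT-tr ρ' ρ (lett P P') _) (cong (tr (lett P P') _) (renT-argCont ρ' h N))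

  renT-headCont : ∀ {n m k} (ρ' : Ren m k) (ρ : Ren n m) Q N →
                  renT (lift ρ') (headCont Q ρ N) ≡ headCont Q (ρ' ∘ ρ) (renT (lift ρ') N)
  renT-headCont ρ' ρ Q N =
    trans (renT-tapp (lift ρ') (suc ∘ ρ) _ Q _)
          (cong (tapp (var zero) Q _) (renT-weaken-comm ρ' N))

trValue : ∀ {n m} {V : Tm n} → IsValue V → Ren n m → VVal m
trValue (var x) ρ = var (ρ x)
trValue (lam M) ρ = tval M ρ

tr-value : ∀ {n m} {V : Tm n} (v : IsValue V) (ρ : Ren n m) K →
           tr V ρ K ≡ cv (trValue v ρ) (abs K)
tr-value (var x) ρ K = refl
tr-value (lam M) ρ K = refl

tr-app-value : ∀ {n m} {V : Tm n} (v : IsValue V) Q (ρ : Ren n m) K →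
               tr (app V Q) ρ K ≡ tapp (trValue v ρ) Q ρ K
tr-app-value (var x) Q ρ K = refl
tr-app-value (lam M) Q ρ K = refl

tapp-value : ∀ {n m} {W : Tm n} (w : IsValue W) h (ρ : Ren n m) K →
             tapp h W ρ K ≡ cv h (pair (trValue w ρ) K)
tapp-value (var x) h ρ K = refl
tapp-value (lam M) h ρ K = refl

tr-app-nonvalue : ∀ {n m} {M : Tm n} → NotValue M → ∀ Q (ρ : Ren n m) K →
                  tr (app M Q) ρ K ≡ tr M ρ (headCont Q ρ K)
tr-app-nonvalue {M = var x}     nv = ⊥-elim (nv (var x))
tr-app-nonvalue {M = lam M}     nv = ⊥-elim (nv (lam M))
tr-app-nonvalue {M = app P P'}  nv Q ρ K = refl
tr-app-nonvalue {M = lett P P'} nv Q ρ K = refl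

tapp-nonvalue : ∀ {n m} {Q : Tm n} → NotValue Q → ∀ h (ρ : Ren n m) K →
                tapp h Q ρ K ≡ tr Q ρ (argCont h K)
tapp-nonvalue {Q = var x}     nv = ⊥-elim (nv (var x))
tapp-nonvalue {Q = lam M}     nv = ⊥-elim (nv (lam M))
tapp-nonvalue {Q = app P P'}  nv h ρ K = refl
tapp-nonvalue {Q = lett P P'} nv h ρ K = refl

renV-trValue : ∀ {n m k} (ρ' : Ren m k) (ρ : Ren n m) {V : Tm n} (v : IsValue V) →
               renV ρ' (trValue v ρ) ≡ trValue v (ρ' ∘ ρ)
renV-trValue ρ' ρ (var x) = refl
renV-trValue ρ' ρ (lam M) = renV-tval ρ' ρ M

trValue-ren : ∀ {n m k} (σ : Ren n m) (ρ : Ren m k) {V : Tm n} (v : IsValue V) →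
              trValue (ren-value σ v) ρ ≡ trValue v (ρ ∘ σ)
trValue-ren σ ρ (var x) = refl
trValue-ren σ ρ (lam M) = tval-ren σ ρ M

-- Hypothesis of the substitution lemma: σ agrees along ρ with the translation of the
-- substitution τ by values

record Translates {n m k k'} (σ : VSub m k') (ρ : Ren n m)
                  (τ : Sub n k) (τ-value : ∀ i → IsValue (τ i)) (ρ' : Ren k k') : Set where
  constructor translates
  field agrees : ∀ i → σ (ρ i) ≡ trValue (τ-value i) ρ'
open Translates

liftS-value : ∀ {n k} {τ : Sub n k} → (∀ i → IsValue (τ i)) → ∀ i → IsValue (liftS τ i)
liftS-value τ-value zero    = var zero
liftS-value τ-value (suc i) = ren-value suc (τ-value i)

Translates-lift : ∀ {n m k k'} {σ : VSub m k'} {ρ : Ren n m} {τ : Sub n k}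
                  {τ-value : ∀ i → IsValue (τ i)} {ρ' : Ren k k'} →
                  Translates σ ρ τ τ-value ρ' →
                  Translates (liftVS σ) (lift ρ) (liftS τ) (liftS-value τ-value) (lift ρ')
Translates-lift {τ-value = τ-value} {ρ' = ρ'} t = translates λ where
  zero    → refl
  (suc i) → trans (cong (renV suc) (agrees t i))
              (trans (renV-trValue suc ρ' (τ-value i))
                     (sym (trValue-ren suc (lift ρ') (τ-value i))))

Translates-weaken : ∀ {n m k k'} {σ : VSub m k'} {ρ : Ren n m} {τ : Sub n k}
                    {τ-value : ∀ i → IsValue (τ i)} {ρ' : Ren k k'} →
                    Translates σ ρ τ τ-value ρ' →
                    Translates (liftVS σ) (suc ∘ ρ) τ τ-value (suc ∘ ρ')
Translates-weaken {τ-value = τ-value} {ρ' = ρ'} t =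
  translates λ i → trans (cong (renV suc) (agrees t i)) (renV-trValue suc ρ' (τ-value i))

subT-argCont : ∀ {m k} (σ : VSub m k) h K →
               subT (liftVS σ) (argCont h K) ≡ argCont (subV σ h) (subT (liftVS σ) K)
subT-argCont σ h K =
  cong₂ (λ a b → cv a (pair (var zero) b)) (subV-weaken σ h) (subT-weaken-comm σ K)

mutual
  subT-tr : ∀ {n m k k'} {σ : VSub m k'} {ρ : Ren n m} {τ : Sub n k}
            {τ-value : ∀ i → IsValue (τ i)} {ρ' : Ren k k'} →
            Translates σ ρ τ τ-value ρ' →
            ∀ M K → subT σ (tr M ρ K) ≡ tr (sub τ M) ρ' (subT (liftVS σ) K)
  subT-tr {σ = σ} {τ-value = τ-value} {ρ' = ρ'} t (var x) K =
    trans (cong (λ z → cv z (abs (subT (liftVS σ) K))) (agrees t x))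
          (sym (tr-value (τ-value x) ρ' _))
  subT-tr {σ = σ} t (lam M) K = cong (λ z → cv z (abs (subT (liftVS σ) K))) (subV-tval t M)
  subT-tr {σ = σ} {ρ} {τ} {τ-value} {ρ'} t (app (var x) Q) K =
    trans (subT-tapp t (var (ρ x)) Q K)
      (trans (cong (λ z → tapp z (sub τ Q) ρ' (subT (liftVS σ) K)) (agrees t x))
             (sym (tr-app-value (τ-value x) (sub τ Q) ρ' _)))
  subT-tr {σ = σ} {ρ} {τ} {ρ' = ρ'} t (app (lam M) Q) K =
    trans (subT-tapp t (tval M ρ) Q K)
          (cong (λ z → tapp z (sub τ Q) ρ' (subT (liftVS σ) K)) (subV-tval t M))
  subT-tr {τ = τ} {ρ' = ρ'} t (app (app P P') Q) K =
    trans (subT-tr t (app P P') _) (cong (tr (sub τ (app P P')) ρ') (subT-headCont t Q K))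
  subT-tr {τ = τ} {ρ' = ρ'} t (app (lett P P') Q) K =
    trans (subT-tr t (lett P P') _) (cong (tr (sub τ (lett P P')) ρ') (subT-headCont t Q K))
  subT-tr {σ = σ} {τ = τ} {ρ' = ρ'} t (lett M P) K =
    trans (subT-tr t M _)
      (cong (tr (sub τ M) ρ')
        (trans (subT-tr (Translates-lift t) P _)
               (cong (tr (sub (liftS τ) P) (lift ρ')) (subT-weaken-comm σ K))))

  subV-tval : ∀ {n m k k'} {σ : VSub m k'} {ρ : Ren n m} {τ : Sub n k}
              {τ-value : ∀ i → IsValue (τ i)} {ρ' : Ren k k'} →
              Translates σ ρ τ τ-value ρ' → ∀ M → subV σ (tval M ρ) ≡ tval (sub (liftS τ) M) ρ'
  subV-tval t M = cong lam (subT-tr (Translates-lift t) M (up (var zero)))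

  subT-tapp : ∀ {n m k k'} {σ : VSub m k'} {ρ : Ren n m} {τ : Sub n k}
              {τ-value : ∀ i → IsValue (τ i)} {ρ' : Ren k k'} →
              Translates σ ρ τ τ-value ρ' →
              ∀ h Q K → subT σ (tapp h Q ρ K) ≡ tapp (subV σ h) (sub τ Q) ρ' (subT (liftVS σ) K)
  subT-tapp {σ = σ} {τ-value = τ-value} {ρ' = ρ'} t h (var y) K =
    trans (cong (λ z → cv (subV σ h) (pair z (subT (liftVS σ) K))) (agrees t y))
          (sym (tapp-value (τ-value y) (subV σ h) ρ' _))
  subT-tapp {σ = σ} t h (lam M) K =
    cong (λ z → cv (subV σ h) (pair z (subT (liftVS σ) K))) (subV-tval t M)
  subT-tapp {σ = σ} {τ = τ} {ρ' = ρ'} t h (app P P') K =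
    trans (subT-tr t (app P P') _) (cong (tr (sub τ (app P P')) ρ') (subT-argCont σ h K))
  subT-tapp {σ = σ} {τ = τ} {ρ' = ρ'} t h (lett P P') K =
    trans (subT-tr t (lett P P') _) (cong (tr (sub τ (lett P P')) ρ') (subT-argCont σ h K))

  subT-headCont : ∀ {n m k k'} {σ : VSub m k'} {ρ : Ren n m} {τ : Sub n k}
                  {τ-value : ∀ i → IsValue (τ i)} {ρ' : Ren k k'} →
                  Translates σ ρ τ τ-value ρ' → ∀ Q K →
                  subT (liftVS σ) (headCont Q ρ K) ≡ headCont (sub τ Q) ρ' (subT (liftVS σ) K)
  subT-headCont {σ = σ} {τ = τ} {ρ' = ρ'} t Q K =
    trans (subT-tapp (Translates-weaken t) (var zero) Q (renT (lift suc) K))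
          (cong (tapp (var zero) (sub τ Q) (suc ∘ ρ')) (subT-weaken-comm σ K))

∶ₜ-weaken : ∀ {m} (K : VTm (suc m)) (c : Ctx m) →
            (renT (lift suc) K ∶ₜ renC suc (renC suc c)) ≡ renT (lift suc) (K ∶ₜ renC suc c)
∶ₜ-weaken K c = sym (renT-lift-∶ₜ suc K c)

mutual
  tr-∶ₜ : ∀ {n m} (M : Tm n) (ρ : Ren n m) K c → (tr M ρ K ∶ₜ c) ≡ tr M ρ (K ∶ₜ renC suc c)
  tr-∶ₜ (var x) ρ K c = refl
  tr-∶ₜ (lam M) ρ K c = refl
  tr-∶ₜ (app (var x) Q) ρ K c = tapp-∶ₜ Q _ ρ K c
  tr-∶ₜ (app (lam M) Q) ρ K c = tapp-∶ₜ Q _ ρ K c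
  tr-∶ₜ (app (app P P') Q) ρ K c =
    trans (tr-∶ₜ (app P P') ρ _ c) (cong (tr (app P P') ρ) (headCont-∶ₜ Q ρ K c))
  tr-∶ₜ (app (lett P P') Q) ρ K c =
    trans (tr-∶ₜ (lett P P') ρ _ c) (cong (tr (lett P P') ρ) (headCont-∶ₜ Q ρ K c))
  tr-∶ₜ (lett M P) ρ K c =
    trans (tr-∶ₜ M ρ _ c)
      (cong (tr M ρ) (trans (tr-∶ₜ P (lift ρ) _ _) (cong (tr P (lift ρ)) (∶ₜ-weaken K c))))

  tapp-∶ₜ : ∀ {n m} (Q : Tm n) h (ρ : Ren n m) K c →
            (tapp h Q ρ K ∶ₜ c) ≡ tapp h Q ρ (K ∶ₜ renC suc c)
  tapp-∶ₜ (var y) h ρ K c = refl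
  tapp-∶ₜ (lam M) h ρ K c = refl
  tapp-∶ₜ (app P P') h ρ K c =
    trans (tr-∶ₜ (app P P') ρ _ c)
          (cong (λ z → tr (app P P') ρ (cv (renV suc h) (pair (var zero) z))) (∶ₜ-weaken K c))
  tapp-∶ₜ (lett P P') h ρ K c =
    trans (tr-∶ₜ (lett P P') ρ _ c)
          (cong (λ z → tr (lett P P') ρ (cv (renV suc h) (pair (var zero) z))) (∶ₜ-weaken K c))

  headCont-∶ₜ : ∀ {n m} (Q : Tm n) (ρ : Ren n m) K c →
                (headCont Q ρ K ∶ₜ renC suc c) ≡ headCont Q ρ (K ∶ₜ renC suc c)
  headCont-∶ₜ Q ρ K c =
    trans (tapp-∶ₜ Q (var zero) (suc ∘ ρ) _ _) (cong (tapp (var zero) Q (suc ∘ ρ)) (∶ₜ-weaken K c))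

mutual
  tr-cont-⟶ᵥ : ∀ {n m} (M : Tm n) (ρ : Ren n m) {K K'} → K ⟶ᵥ K' → tr M ρ K ⟶ᵥ tr M ρ K'
  tr-cont-⟶ᵥ (var x) ρ s = cvᵣ (absξ s)
  tr-cont-⟶ᵥ (lam M) ρ s = cvᵣ (absξ s)
  tr-cont-⟶ᵥ (app (var x) Q) ρ s = tapp-cont-⟶ᵥ Q _ ρ s
  tr-cont-⟶ᵥ (app (lam M) Q) ρ s = tapp-cont-⟶ᵥ Q _ ρ s
  tr-cont-⟶ᵥ (app (app P P') Q) ρ s =
    tr-cont-⟶ᵥ (app P P') ρ (tapp-cont-⟶ᵥ Q (var zero) (suc ∘ ρ) (⟶ᵥ-renT (lift suc) s))
  tr-cont-⟶ᵥ (app (lett P P') Q) ρ s =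
    tr-cont-⟶ᵥ (lett P P') ρ (tapp-cont-⟶ᵥ Q (var zero) (suc ∘ ρ) (⟶ᵥ-renT (lift suc) s))
  tr-cont-⟶ᵥ (lett M P) ρ s = tr-cont-⟶ᵥ M ρ (tr-cont-⟶ᵥ P (lift ρ) (⟶ᵥ-renT (lift suc) s))

  tapp-cont-⟶ᵥ : ∀ {n m} (Q : Tm n) h (ρ : Ren n m) {K K'} → K ⟶ᵥ K' →
                 tapp h Q ρ K ⟶ᵥ tapp h Q ρ K'
  tapp-cont-⟶ᵥ (var y)     h ρ s = cvᵣ (pairᵣ s)
  tapp-cont-⟶ᵥ (lam M)     h ρ s = cvᵣ (pairᵣ s)
  tapp-cont-⟶ᵥ (app P P')  h ρ s = tr-cont-⟶ᵥ (app P P') ρ (cvᵣ (pairᵣ (⟶ᵥ-renT (lift suc) s)))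
  tapp-cont-⟶ᵥ (lett P P') h ρ s = tr-cont-⟶ᵥ (lett P P') ρ (cvᵣ (pairᵣ (⟶ᵥ-renT (lift suc) s)))

tr-cont-⟶ᵥ* : ∀ {n m} (M : Tm n) (ρ : Ren n m) {K K'} → K ⟶ᵥ* K' → tr M ρ K ⟶ᵥ* tr M ρ K'
tr-cont-⟶ᵥ* M ρ = gmap (tr M ρ) (tr-cont-⟶ᵥ M ρ)

tapp-head-⟶ᵥ : ∀ {n m} (Q : Tm n) {h h'} (ρ : Ren n m) K → h ⟶ᵛ h' → tapp h Q ρ K ⟶ᵥ tapp h' Q ρ K
tapp-head-⟶ᵥ (var y)     ρ K s = cvₗ s
tapp-head-⟶ᵥ (lam M)     ρ K s = cvₗ s
tapp-head-⟶ᵥ (app P P')  ρ K s = tr-cont-⟶ᵥ (app P P') ρ (cvₗ (⟶ᵛ-renV suc s))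
tapp-head-⟶ᵥ (lett P P') ρ K s = tr-cont-⟶ᵥ (lett P P') ρ (cvₗ (⟶ᵛ-renV suc s))

-- Root steps

liftVS-vsingle-weaken : ∀ {n} (h : VVal n) → liftVS (vsingle h) ∘ lift suc ≗ var
liftVS-vsingle-weaken h zero    = refl
liftVS-vsingle-weaken h (suc i) = refl

vsingle-var-weaken : ∀ {n} → vsingle (var zero) ∘ lift suc ≗ var {suc n}
vsingle-var-weaken zero    = refl
vsingle-var-weaken (suc i) = refl

tr-value-σv : ∀ {n m} {V : Tm n} (v : IsValue V) (ρ : Ren n m) (K : VTm (suc m)) →
              tr V ρ K ⟶ᵥ subT (vsingle (trValue v ρ)) K
tr-value-σv v ρ K = subst (_⟶ᵥ subT (vsingle (trValue v ρ)) K) (sym (tr-value v ρ K)) (top (σv _ K))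

let₁-invariant : ∀ {n m} (M N : Tm n) → NotValue M → (ρ : Ren n m) (K : VTm (suc m)) →
                 tr (app M N) ρ K ≡ tr (lett M (app (var zero) (ren suc N))) ρ K
let₁-invariant M N nv ρ K =
  trans (tr-app-nonvalue nv N ρ K) (cong (tr M ρ) (sym (tapp-ren suc (lift ρ) (var zero) N _)))

let₂-invariant : ∀ {n m} (V N : Tm n) → IsValue V → NotValue N → (ρ : Ren n m) (K : VTm (suc m)) →
                 tr (app V N) ρ K ≡ tr (lett N (app (ren suc V) (var zero))) ρ K
let₂-invariant V N v nv ρ K = begin
  tr (app V N) ρ K                              ≡⟨ tr-app-value v N ρ K ⟩
  tapp (trValue v ρ) N ρ K                      ≡⟨ tapp-nonvalue nv _ ρ K ⟩
  tr N ρ (argCont (trValue v ρ) K)              ≡⟨ cong (λ h → tr N ρ (cv h _)) weaken-trValue ⟩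
  tr N ρ (cv (trValue (ren-value suc v) (lift ρ)) (pair (var zero) (renT (lift suc) K)))
    ≡⟨ cong (tr N ρ) (sym (tr-app-value (ren-value suc v) (var zero) (lift ρ) _)) ⟩
  tr (lett N (app (ren suc V) (var zero))) ρ K  ∎
  where
    open ≡-Reasoning
    weaken-trValue : renV suc (trValue v ρ) ≡ trValue (ren-value suc v) (lift ρ)
    weaken-trValue = trans (renV-trValue suc ρ v) (sym (trValue-ren suc (lift ρ) v))

assoc-invariant : ∀ {n m} (M : Tm n) (N P : Tm (suc n)) (ρ : Ren n m) (K : VTm (suc m)) →
                  tr (lett (lett M N) P) ρ K ≡ tr (lett M (lett N (ren (lift suc) P))) ρ K
assoc-invariant M N P ρ K = cong (tr M ρ ∘ tr N (lift ρ)) (begin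
  renT (lift suc) (tr P (lift ρ) (renT (lift suc) K))
    ≡⟨ renT-tr (lift suc) (lift ρ) P _ ⟩
  tr P (lift suc ∘ lift ρ) (renT (lift (lift suc)) (renT (lift suc) K))
    ≡⟨ tr-cong lift-suc-comm P _ ⟩
  tr P (lift (lift ρ) ∘ lift suc) (renT (lift (lift suc)) (renT (lift suc) K))
    ≡⟨ cong (tr P _) (renT-weaken-comm suc K) ⟩
  tr P (lift (lift ρ) ∘ lift suc) (renT (lift suc) (renT (lift suc) K))
    ≡⟨ sym (tr-ren (lift suc) (lift (lift ρ)) P _) ⟩
  tr (ren (lift suc) P) (lift (lift ρ)) (renT (lift suc) (renT (lift suc) K)) ∎)
  where
    open ≡-Reasoning
    lift-suc-comm : lift suc ∘ lift ρ ≗ lift (lift ρ) ∘ lift suc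
    lift-suc-comm zero    = refl
    lift-suc-comm (suc i) = refl

-- A B_v-redex with a translated abstraction: B_v, then σ_v on the identity continuation
-- that the colon operation has exposed
tval-β : ∀ {n m} (M : Tm (suc n)) (ρ : Ren n m) W K →
         cv (tval M ρ) (pair W K) ⟶ᵥ* cv W (abs (tr M (lift ρ) (renT (lift suc) K)))
tval-β M ρ W K = top (Bv _ W K) ◅ gmap (cv W ∘ abs) (cvᵣ ∘ absξ) (begin
  (tr M (lift ρ) (up (var zero)) ∶ₜ renC suc (abs K))
    ≡⟨ tr-∶ₜ M (lift ρ) (up (var zero)) (renC suc (abs K)) ⟩
  tr M (lift ρ) (cv (var zero) (abs (renT (lift suc) (renT (lift suc) K))))
    ⟶⟨ tr-cont-⟶ᵥ M (lift ρ) (top (σv (var zero) _)) ⟩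
  tr M (lift ρ) (subT (vsingle (var zero)) (renT (lift suc) (renT (lift suc) K)))
    ≡⟨ cong (tr M (lift ρ)) (subT-renT-id vsingle-var-weaken _) ⟩
  tr M (lift ρ) (renT (lift suc) K) ∎)
  where open StarReasoning _⟶ᵥ_

B-simulation : ∀ {n m} (M : Tm (suc n)) (N : Tm n) (ρ : Ren n m) (K : VTm (suc m)) →
               tr (app (lam M) N) ρ K ⟶ᵥ* tr (lett N M) ρ K
B-simulation {m = m} M N ρ K with isValue? N
... | yes w = begin
  tapp (tval M ρ) N ρ K                               ≡⟨ tapp-value w (tval M ρ) ρ K ⟩
  cv (tval M ρ) (pair (trValue w ρ) K)                ⟶*⟨ tval-β M ρ (trValue w ρ) K ⟩
  cv (trValue w ρ) (abs (tr M (lift ρ) (renT (lift suc) K))) ≡⟨ sym (tr-value w ρ _) ⟩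
  tr N ρ (tr M (lift ρ) (renT (lift suc) K))          ∎
  where open StarReasoning _⟶ᵥ_
... | no nv =
  reflexive _⟶ᵥ_ (tapp-nonvalue nv (tval M ρ) ρ K) ◅◅ tr-cont-⟶ᵥ* N ρ body
  where
    open StarReasoning (_⟶ᵥ_ {suc m})
    K' = renT (lift suc) K
    -- the final σ_v step identifies the λ-bound variable with the let-bound one
    identify : Translates (vsingle (var zero)) (lift (suc ∘ ρ)) var var (lift ρ)
    identify = translates λ where
      zero    → refl
      (suc i) → refl
    body : argCont (tval M ρ) K ⟶ᵥ* tr M (lift ρ) K'
    body = begin
      cv (renV suc (tval M ρ)) (pair (var zero) K')
        ≡⟨ cong (λ h → cv h (pair (var zero) K')) (renV-tval suc ρ M) ⟩
      cv (tval M (suc ∘ ρ)) (pair (var zero) K')      ⟶*⟨ tval-β M (suc ∘ ρ) (var zero) K' ⟩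
      cv (var zero) (abs (tr M (lift (suc ∘ ρ)) (renT (lift suc) K')))
        ⟶⟨ top (σv (var zero) _) ⟩
      subT (vsingle (var zero)) (tr M (lift (suc ∘ ρ)) (renT (lift suc) K'))
        ≡⟨ subT-tr identify M _ ⟩
      tr (sub var M) (lift ρ) (subT (liftVS (vsingle (var zero))) (renT (lift suc) K'))
        ≡⟨ cong₂ (λ a b → tr a (lift ρ) b) (sub-id (λ _ → refl) M)
                 (subT-renT-id (liftVS-vsingle-weaken (var zero)) K') ⟩
      tr M (lift ρ) K'                                ∎

letv-simulation : ∀ {n m} (V : Tm n) (M : Tm (suc n)) (v : IsValue V)
                  (ρ : Ren n m) (K : VTm (suc m)) →
                  tr (lett V M) ρ K ⟶ᵥ* tr (M [ V /0]) ρ K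
letv-simulation V M v ρ K = begin
  tr V ρ (tr M (lift ρ) (renT (lift suc) K))
    ⟶⟨ tr-value-σv v ρ _ ⟩
  subT (vsingle (trValue v ρ)) (tr M (lift ρ) (renT (lift suc) K))
    ≡⟨ subT-tr instantiate M _ ⟩
  tr (M [ V /0]) ρ (subT (liftVS (vsingle (trValue v ρ))) (renT (lift suc) K))
    ≡⟨ cong (tr (M [ V /0]) ρ) (subT-renT-id (liftVS-vsingle-weaken _) K) ⟩
  tr (M [ V /0]) ρ K ∎
  where
    open StarReasoning _⟶ᵥ_
    single-value : ∀ i → IsValue (single V i)
    single-value zero    = v
    single-value (suc i) = var i
    instantiate : Translates (vsingle (trValue v ρ)) (lift ρ) (single V) single-value ρ
    instantiate = translates λ where
      zero    → refl
      (suc i) → refl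

ηlet-simulation : ∀ {n m} (M : Tm n) (ρ : Ren n m) (K : VTm (suc m)) →
                  tr (lett M (var zero)) ρ K ⟶ᵥ* tr M ρ K
ηlet-simulation M ρ K =
  tr-cont-⟶ᵥ M ρ (top (σv (var zero) _))
    ◅ reflexive _⟶ᵥ_ (cong (tr M ρ) (subT-renT-id vsingle-var-weaken K))

Top-simulation : ∀ {R n m} {M M' : Tm n} → Top R M M' →
                 (ρ : Ren n m) (K : VTm (suc m)) → tr M ρ K ⟶ᵥ* tr M' ρ K
Top-simulation (B M N)         ρ K = B-simulation M N ρ K
Top-simulation (letv V M v)    ρ K = letv-simulation V M v ρ K
Top-simulation (ηlet M)        ρ K = ηlet-simulation M ρ K
Top-simulation (assoc M N P)   ρ K = reflexive _⟶ᵥ_ (assoc-invariant M N P ρ K)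
Top-simulation (let1 M N nv)   ρ K = reflexive _⟶ᵥ_ (let₁-invariant M N nv ρ K)
Top-simulation (let2 V N v nv) ρ K = reflexive _⟶ᵥ_ (let₂-invariant V N v nv ρ K)

-- Reduction under a constructor

tr-headCont-⟶ᵥ* : ∀ {n m} (M : Tm n) Q (ρ : Ren n m) (K : VTm (suc m)) →
                  tr M ρ (headCont Q ρ K) ⟶ᵥ* tr (app M Q) ρ K
tr-headCont-⟶ᵥ* M Q ρ K with isValue? M
... | no nv = reflexive _⟶ᵥ_ (sym (tr-app-nonvalue nv Q ρ K))
... | yes v = tr-value-σv v ρ _ ◅ reflexive _⟶ᵥ_ (begin
  subT (vsingle (trValue v ρ)) (headCont Q ρ K)
    ≡⟨ subT-tapp (translates λ _ → refl) (var zero) Q (renT (lift suc) K) ⟩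
  tapp (trValue v ρ) (sub var Q) ρ (subT (liftVS (vsingle (trValue v ρ))) (renT (lift suc) K))
    ≡⟨ cong₂ (λ Q' K' → tapp (trValue v ρ) Q' ρ K')
             (sub-id (λ _ → refl) Q) (subT-renT-id (liftVS-vsingle-weaken _) K) ⟩
  tapp (trValue v ρ) Q ρ K
    ≡⟨ sym (tr-app-value v Q ρ K) ⟩
  tr (app M Q) ρ K ∎)
  where open ≡-Reasoning

tr-argCont-⟶ᵥ* : ∀ {n m} (Q : Tm n) h (ρ : Ren n m) (K : VTm (suc m)) →
                 tr Q ρ (argCont h K) ⟶ᵥ* tapp h Q ρ K
tr-argCont-⟶ᵥ* Q h ρ K with isValue? Q
... | no nv = reflexive _⟶ᵥ_ (sym (tapp-nonvalue nv h ρ K))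
... | yes v = tr-value-σv v ρ _ ◅ reflexive _⟶ᵥ_ (begin
  subT (vsingle (trValue v ρ)) (argCont h K)
    ≡⟨ cong₂ (λ h' K' → cv h' (pair (trValue v ρ) K'))
             (trans (subV-renV _ suc h) (subV-id (λ _ → refl) h))
             (subT-renT-id (liftVS-vsingle-weaken _) K) ⟩
  cv h (pair (trValue v ρ) K)
    ≡⟨ sym (tapp-value v h ρ K) ⟩
  tapp h Q ρ K ∎)
  where open ≡-Reasoning

app-head-simulation : ∀ {n m} (M M' Q : Tm n) (ρ : Ren n m) (K : VTm (suc m)) → NotValue M →
                      tr M ρ (headCont Q ρ K) ⟶ᵥ* tr M' ρ (headCont Q ρ K) →
                      tr (app M Q) ρ K ⟶ᵥ* tr (app M' Q) ρ K
app-head-simulation M M' Q ρ K nv steps =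
  reflexive _⟶ᵥ_ (tr-app-nonvalue nv Q ρ K) ◅◅ steps ◅◅ tr-headCont-⟶ᵥ* M' Q ρ K

app-arg-simulation : ∀ {n m} (Q Q' : Tm n) h (ρ : Ren n m) (K : VTm (suc m)) → NotValue Q →
                     tr Q ρ (argCont h K) ⟶ᵥ* tr Q' ρ (argCont h K) →
                     tapp h Q ρ K ⟶ᵥ* tapp h Q' ρ K
app-arg-simulation Q Q' h ρ K nv steps =
  reflexive _⟶ᵥ_ (tapp-nonvalue nv h ρ K) ◅◅ steps ◅◅ tr-argCont-⟶ᵥ* Q' h ρ K

mutual
  simulation : ∀ {R n m} {M M' : Tm n} → R ⊢ M ⟶ M' →
               (ρ : Ren n m) (K : VTm (suc m)) → tr M ρ K ⟶ᵥ* tr M' ρ K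
  simulation (top t)  ρ K = Top-simulation t ρ K
  simulation (lamξ s) ρ K = gmap (λ h → cv h (abs K)) cvₗ (tval-simulation s ρ)
  simulation (appₗ {M = var x} s) ρ K = ⊥-elim (var-irreducible s)
  simulation (appₗ {M = lam _} (top ()))
  simulation (appₗ {M = lam _} {N = Q} (lamξ s)) ρ K =
    gmap (λ h → tapp h Q ρ K) (tapp-head-⟶ᵥ Q ρ K) (tval-simulation s ρ)
  simulation (appₗ {M = M@(app _ _)}  {M'} {Q} s) ρ K =
    app-head-simulation M M' Q ρ K (λ ()) (simulation s ρ _)
  simulation (appₗ {M = M@(lett _ _)} {M'} {Q} s) ρ K =
    app-head-simulation M M' Q ρ K (λ ()) (simulation s ρ _)
  simulation (appᵣ {M = var x}  s) ρ K = arg-simulation s (var (ρ x)) ρ K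
  simulation (appᵣ {M = lam M}  s) ρ K = arg-simulation s (tval M ρ) ρ K
  simulation (appᵣ {M = M@(app _ _)}  s) ρ K =
    tr-cont-⟶ᵥ* M ρ (arg-simulation s (var zero) (suc ∘ ρ) _)
  simulation (appᵣ {M = M@(lett _ _)} s) ρ K =
    tr-cont-⟶ᵥ* M ρ (arg-simulation s (var zero) (suc ∘ ρ) _)
  simulation (letₗ s) ρ K = simulation s ρ _
  simulation (letᵣ {M = M} s) ρ K = tr-cont-⟶ᵥ* M ρ (simulation s (lift ρ) _)

  tval-simulation : ∀ {R n m} {M M' : Tm (suc n)} → R ⊢ M ⟶ M' →
                    (ρ : Ren n m) → tval M ρ ⟶ᵛ* tval M' ρ
  tval-simulation s ρ = gmap lam lamξ (simulation s (lift ρ) (up (var zero)))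

  arg-simulation : ∀ {R n m} {Q Q' : Tm n} → R ⊢ Q ⟶ Q' →
                   ∀ h (ρ : Ren n m) (K : VTm (suc m)) → tapp h Q ρ K ⟶ᵥ* tapp h Q' ρ K
  arg-simulation {Q = var x} s h ρ K = ⊥-elim (var-irreducible s)
  arg-simulation {Q = lam _} (top ()) h ρ K
  arg-simulation {Q = lam _} (lamξ s) h ρ K =
    gmap (λ v → cv h (pair v K)) (cvᵣ ∘ pairₗ) (tval-simulation s ρ)
  arg-simulation {Q = Q@(app _ _)}  {Q'} s h ρ K =
    app-arg-simulation Q Q' h ρ K (λ ()) (simulation s ρ _)
  arg-simulation {Q = Q@(lett _ _)} {Q'} s h ρ K =
    app-arg-simulation Q Q' h ρ K (λ ()) (simulation s ρ _)

-- The administrative rules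

Administrative : Rule → Set
Administrative R = (R ≡ let1) ⊎ (R ≡ let2) ⊎ (R ≡ assoc)

Top-administrative-nonvalue : ∀ {R n} {M M' : Tm n} → Administrative R → Top R M M' → NotValue M'
Top-administrative-nonvalue (inj₁ refl)        (let1 _ _ _)   ()
Top-administrative-nonvalue (inj₂ (inj₁ refl)) (let2 _ _ _ _) ()
Top-administrative-nonvalue (inj₂ (inj₂ refl)) (assoc _ _ _)  ()

administrative-preserves-nonvalue : ∀ {R n} {M M' : Tm n} → Administrative R →
                                    R ⊢ M ⟶ M' → NotValue M → NotValue M'
administrative-preserves-nonvalue a (top t)  nv = Top-administrative-nonvalue a t
administrative-preserves-nonvalue a (lamξ s) nv = ⊥-elim (nv (lam _))

Top-invariance : ∀ {R n m} {M M' : Tm n} → Administrative R → Top R M M' →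
                 (ρ : Ren n m) (K : VTm (suc m)) → tr M ρ K ≡ tr M' ρ K
Top-invariance (inj₁ refl)        (let1 M N nv)   = let₁-invariant M N nv
Top-invariance (inj₂ (inj₁ refl)) (let2 V N v nv) = let₂-invariant V N v nv
Top-invariance (inj₂ (inj₂ refl)) (assoc M N P)   = assoc-invariant M N P

app-head-invariance : ∀ {n m} (M M' Q : Tm n) (ρ : Ren n m) (K : VTm (suc m)) →
                      NotValue M → NotValue M' →
                      tr M ρ (headCont Q ρ K) ≡ tr M' ρ (headCont Q ρ K) →
                      tr (app M Q) ρ K ≡ tr (app M' Q) ρ K
app-head-invariance M M' Q ρ K nv nv' eq =
  trans (tr-app-nonvalue nv Q ρ K) (trans eq (sym (tr-app-nonvalue nv' Q ρ K)))

app-arg-invariance : ∀ {n m} (Q Q' : Tm n) h (ρ : Ren n m) (K : VTm (suc m)) →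
                     NotValue Q → NotValue Q' →
                     tr Q ρ (argCont h K) ≡ tr Q' ρ (argCont h K) →
                     tapp h Q ρ K ≡ tapp h Q' ρ K
app-arg-invariance Q Q' h ρ K nv nv' eq =
  trans (tapp-nonvalue nv h ρ K) (trans eq (sym (tapp-nonvalue nv' h ρ K)))

mutual
  invariance : ∀ {R n m} {M M' : Tm n} → Administrative R → R ⊢ M ⟶ M' →
               (ρ : Ren n m) (K : VTm (suc m)) → tr M ρ K ≡ tr M' ρ K
  invariance a (top t)  ρ K = Top-invariance a t ρ K
  invariance a (lamξ s) ρ K = cong (λ h → cv h (abs K)) (tval-invariance a s ρ)
  invariance a (appₗ {M = var x} s) ρ K = ⊥-elim (var-irreducible s)
  invariance a (appₗ {M = lam _} (top ()))
  invariance a (appₗ {M = lam _} {N = Q} (lamξ s)) ρ K =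
    cong (λ h → tapp h Q ρ K) (tval-invariance a s ρ)
  invariance a (appₗ {M = M@(app _ _)} {M'} {Q} s) ρ K =
    app-head-invariance M M' Q ρ K (λ ()) (administrative-preserves-nonvalue a s (λ ()))
      (invariance a s ρ _)
  invariance a (appₗ {M = M@(lett _ _)} {M'} {Q} s) ρ K =
    app-head-invariance M M' Q ρ K (λ ()) (administrative-preserves-nonvalue a s (λ ()))
      (invariance a s ρ _)
  invariance a (appᵣ {M = var x} s) ρ K = arg-invariance a s (var (ρ x)) ρ K
  invariance a (appᵣ {M = lam M} s) ρ K = arg-invariance a s (tval M ρ) ρ K
  invariance a (appᵣ {M = M@(app _ _)}  s) ρ K =
    cong (tr M ρ) (arg-invariance a s (var zero) (suc ∘ ρ) _)
  invariance a (appᵣ {M = M@(lett _ _)} s) ρ K =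
    cong (tr M ρ) (arg-invariance a s (var zero) (suc ∘ ρ) _)
  invariance a (letₗ s) ρ K = invariance a s ρ _
  invariance a (letᵣ {M = M} s) ρ K = cong (tr M ρ) (invariance a s (lift ρ) _)

  tval-invariance : ∀ {R n m} {M M' : Tm (suc n)} → Administrative R → R ⊢ M ⟶ M' →
                    (ρ : Ren n m) → tval M ρ ≡ tval M' ρ
  tval-invariance a s ρ = cong lam (invariance a s (lift ρ) (up (var zero)))

  arg-invariance : ∀ {R n m} {Q Q' : Tm n} → Administrative R → R ⊢ Q ⟶ Q' →
                   ∀ h (ρ : Ren n m) (K : VTm (suc m)) → tapp h Q ρ K ≡ tapp h Q' ρ K
  arg-invariance {Q = var x} a s h ρ K = ⊥-elim (var-irreducible s)
  arg-invariance {Q = lam _} a (top ()) h ρ K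
  arg-invariance {Q = lam _} a (lamξ s) h ρ K =
    cong (λ v → cv h (pair v K)) (tval-invariance a s ρ)
  arg-invariance {Q = Q@(app _ _)} {Q'} a s h ρ K =
    app-arg-invariance Q Q' h ρ K (λ ()) (administrative-preserves-nonvalue a s (λ ()))
      (invariance a s ρ _)
  arg-invariance {Q = Q@(lett _ _)} {Q'} a s h ρ K =
    app-arg-invariance Q Q' h ρ K (λ ()) (administrative-preserves-nonvalue a s (λ ()))
      (invariance a s ρ _)

-- Simulation holds for every rule.
theorem1 :
    (∀ (R : Rule) → (R ≡ B) ⊎ (R ≡ letv) ⊎ (R ≡ ηlet) →
       ∀ {n : ℕ} (M N : Tm n) → R ⊢ M ⟶ N → (M •) ⟶ᵥ* (N •))
    ×
    (∀ (R : Rule) → (R ≡ let1) ⊎ (R ≡ let2) ⊎ (R ≡ assoc) →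
       ∀ {n : ℕ} (M N : Tm n) → R ⊢ M ⟶ N → (M •) ≡ (N •))
theorem1 =
    (λ R _ M N s → simulation s id (up (var zero)))
  , (λ R administrative M N s → invariance administrative s id (up (var zero)))
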